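{- Let $(X,R)$ be the 3-cyclic forcing network and let the complete graph $K_n$ be $X$-colored so that each of the colors $1,2,3$ appears at least once in the initial coloring $\ell_0(K_n)$. Then, with forcing with propagation, the end state $\epsilon(\ell_0(K_n))$ has all vertices colored $3$.
   Context: The 3-cyclic forcing network is $X=\{1,2,3\}$ with the ordered list of rules $R=(1\to 2,\,2\to 3,\,3\to 1)$. Applying a rule $a\to b$ in a forcing step means simultaneously recoloring with $a$ every vertex of color $b$ having a neighbor of color $a$; a propagating forcing step with rule $a\to b$ repeats forcing steps with that rule until no vertex of color $b$ has a neighbor of color $a$. The process with propagation applies propagating forcing steps with the rules in cyclic order $1\to2,2\to3,3\to1,1\to2,\dots$ until no rule can be applied; the final coloring is the end state. -}

module Defs where

open import Data.Nat using (ℕ)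
open import Data.Fin using (Fin; zero; suc)
open import Data.Product using (_×_; ∃; ∃-syntax; _,_)
open import Relation.Nullary using (¬_)
open import Relation.Binary.PropositionalEquality using (_≡_; _≢_)
open import Relation.Binary.Construct.Closure.ReflexiveTransitive using (Star)

data Color : Set where
  c1 c2 c3 : Color

Graph : ℕ → Set₁
Graph n = Fin n → Fin n → Set

K : (n : ℕ) → Graph n
K n u v = u ≢ v

Coloring : ℕ → Set
Coloring n = Fin n → Color

record Rule : Set where
  constructor _⟶_
  field
    src tgt : Color
open Rule public

rule : Fin 3 → Rule
rule zero = c1 ⟶ c2
rule (suc zero) = c2 ⟶ c3
rule (suc (suc zero)) = c3 ⟶ c1

next : Fin 3 → Fin 3
next zero = suc zero
next (suc zero) = suc (suc zero)
next (suc (suc zero)) = zero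

module _ {n : ℕ} (G : Graph n) where

  Forced : Rule → Coloring n → Fin n → Set
  Forced r c v = (c v ≡ tgt r) × ∃[ u ] (G v u × c u ≡ src r)

  Applicable : Rule → Coloring n → Set
  Applicable r c = ∃[ v ] Forced r c v

  ForcingStep : Rule → Coloring n → Coloring n → Set
  ForcingStep r c c' =
    ∀ v → (Forced r c v → c' v ≡ src r) × (¬ Forced r c v → c' v ≡ c v)

  PropagatingStep : Rule → Coloring n → Coloring n → Set
  PropagatingStep r c c' = Star (ForcingStep r) c c' × ¬ Applicable r c'

  Stable : Coloring n → Set
  Stable c = ∀ i → ¬ Applicable (rule i) c

  data Run : Fin 3 → Coloring n → Coloring n → Set where
    done : ∀ {i c} → Stable c → Run i c c
    step : ∀ {i c c' e} → PropagatingStep (rule i) c c' → Run (next i) c' e → Run i c e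

  EndState : Coloring n → Coloring n → Set
  EndState c e = Run zero c e

-- In K n every two vertices of different colours are adjacent, so as long as the
-- source colour of a rule is present, its propagating step removes the target colour
-- altogether (one forcing step suffices), while the source colour survives. Starting
-- with all three colours: 1 → 2 removes colour 2 and keeps 1 and 3; 2 → 3 then changes
-- nothing; 3 → 1 removes colour 1 and cannot reintroduce 2. The coloring is now
-- constantly 3, which no rule changes. At each earlier stage some rule still applies,
-- so the process cannot stop before.
module Submission where

open import Defs
open import Data.Nat using (ℕ)
open import Data.Fin using (zero; suc)
open import Data.Product using (_×_; ∃-syntax; _,_; proj₁; proj₂)
open import Data.Empty using (⊥-elim)
open import Function using (id; _∘_)
open import Relation.Nullary using (¬_; Dec; yes; no)
open import Relation.Binary.Definitions using (_Respects_)
open import Relation.Binary.PropositionalEquality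
  using (_≡_; _≢_; _≗_; refl; sym; trans)
open import Relation.Binary.Construct.Closure.ReflexiveTransitive using (Star; ε; _◅_; fold)

_≟_ : (x y : Color) → Dec (x ≡ y)
c1 ≟ c1 = yes refl
c1 ≟ c2 = no λ ()
c1 ≟ c3 = no λ ()
c2 ≟ c1 = no λ ()
c2 ≟ c2 = yes refl
c2 ≟ c3 = no λ ()
c3 ≟ c1 = no λ ()
c3 ≟ c2 = no λ ()
c3 ≟ c3 = yes refl

rule-src≢tgt : ∀ i → src (rule i) ≢ tgt (rule i)
rule-src≢tgt zero ()
rule-src≢tgt (suc zero) ()
rule-src≢tgt (suc (suc zero)) ()

module _ {n : ℕ} where

  Present : Coloring n → Color → Set
  Present c x = ∃[ v ] c v ≡ x

  Absent : Coloring n → Color → Set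
  Absent c x = ∀ v → c v ≢ x

  Monochrome : Coloring n → Color → Set
  Monochrome c x = ∀ v → c v ≡ x

  Present-resp-≗ : ∀ {c c' x} → c ≗ c' → Present c x → Present c' x
  Present-resp-≗ c≗c' (v , cv≡x) = v , trans (sym (c≗c' v)) cv≡x

  Absent-resp-≗ : ∀ {c c' x} → c ≗ c' → Absent c x → Absent c' x
  Absent-resp-≗ c≗c' x∉c v c'v≡x = x∉c v (trans (c≗c' v) c'v≡x)

  only-c3 : ∀ {c} → Absent c c1 → Absent c c2 → Monochrome c c3
  only-c3 {c} c1∉c c2∉c v with c v in cv
  ... | c1 = ⊥-elim (c1∉c v cv)
  ... | c2 = ⊥-elim (c2∉c v cv)
  ... | c3 = refl

  star-respects : ∀ {T : Coloring n → Coloring n → Set} {P : Coloring n → Set} →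
    P Respects T → P Respects Star T
  star-respects {P = P} resp = fold (λ c c' → P c → P c') (λ t f → f ∘ resp t) id

  module _ (G : Graph n) {r : Rule} where

    absent-src⇒inapplicable : ∀ {c} → Absent c (src r) → ¬ Applicable G r c
    absent-src⇒inapplicable src∉c (_ , _ , u , _ , cu) = src∉c u cu

    absent-tgt⇒inapplicable : ∀ {c} → Absent c (tgt r) → ¬ Applicable G r c
    absent-tgt⇒inapplicable tgt∉c (v , cv , _) = tgt∉c v cv

    step-keeps : ∀ {c c'} → ForcingStep G r c c' → ∀ {v} → c v ≢ tgt r → c' v ≡ c v
    step-keeps fs {v} cv≢tgt = proj₂ (fs v) (cv≢tgt ∘ proj₁)

    step-fixes-inapplicable : ∀ {c c'} → ¬ Applicable G r c → ForcingStep G r c c' → c' ≗ c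
    step-fixes-inapplicable na fs v = proj₂ (fs v) (λ forced → na (v , forced))

    Present-respects-step : ∀ {x} → x ≢ tgt r → (λ c → Present c x) Respects ForcingStep G r
    Present-respects-step x≢tgt fs (v , cv) = v , trans (step-keeps fs (x≢tgt ∘ trans (sym cv))) cv

    -- A vertex either keeps its colour or takes the colour src r.
    Absent-respects-step : ∀ {x} → src r ≢ x → (λ c → Absent c x) Respects ForcingStep G r
    Absent-respects-step src≢x {c} fs x∉c v c'v≡x =
      x∉c v (trans (sym (proj₂ (fs v) unforced)) c'v≡x)
      where
      unforced : ¬ Forced G r c v
      unforced forced = src≢x (trans (sym (proj₁ (fs v) forced)) c'v≡x)

    star-fixes-absent-src : ∀ {c c'} → Absent c (src r) → Star (ForcingStep G r) c c' → c' ≗ c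
    star-fixes-absent-src src∉c ε v = refl
    star-fixes-absent-src {c} src∉c (_◅_ {j = c₁} fs fss) v =
      trans (star-fixes-absent-src (Absent-resp-≗ (sym ∘ c₁≗c) src∉c) fss v) (c₁≗c v)
      where
      c₁≗c : c₁ ≗ c
      c₁≗c = step-fixes-inapplicable (absent-src⇒inapplicable src∉c) fs

  module _ (G : Graph n) {x : Color} where

    monochrome-stable : ∀ {c} → Monochrome c x → Stable G c
    monochrome-stable mono i (v , cv , u , _ , cu) =
      rule-src≢tgt i (trans (sym cu) (trans (mono u) (trans (sym (mono v)) cv)))

    Monochrome-respects-step : ∀ {i} → (λ c → Monochrome c x) Respects ForcingStep G (rule i)
    Monochrome-respects-step {i} fs mono v =
      trans (step-fixes-inapplicable G (monochrome-stable mono i) fs v) (mono v)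

    run-monochrome : ∀ {i c e} → Monochrome c x → Run G i c e → Monochrome e x
    run-monochrome mono (done _) = mono
    run-monochrome {i} mono (step (fss , _) run) =
      run-monochrome (star-respects (Monochrome-respects-step {i}) fss mono) run

  module _ {r : Rule} (src≢tgt : src r ≢ tgt r) where

    K-forced : ∀ {c u v} → c u ≡ src r → c v ≡ tgt r → Forced (K n) r c v
    K-forced {u = u} cu cv = cv , u , (λ { refl → src≢tgt (trans (sym cu) cv) }) , cu

    K-applicable : ∀ {c} → Present c (src r) → Present c (tgt r) → Applicable (K n) r c
    K-applicable (u , cu) (v , cv) = v , K-forced cu cv

    K-propagating : ∀ {c c'} → Present c (src r) → PropagatingStep (K n) r c c' →
      Present c' (src r) × Absent c' (tgt r)
    K-propagating {c' = c'} src∈c (fss , na) =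
      src∈c' , λ v cv → na (K-applicable src∈c' (v , cv))
      where
      src∈c' : Present c' (src r)
      src∈c' = star-respects (Present-respects-step (K n) src≢tgt) fss src∈c

    saturate : Coloring n → Coloring n
    saturate c v with c v ≟ tgt r
    ... | yes _ = src r
    ... | no _ = c v

    saturate-absent-tgt : ∀ c → Absent (saturate c) (tgt r)
    saturate-absent-tgt c v with c v ≟ tgt r
    ... | yes _ = src≢tgt
    ... | no cv≢tgt = cv≢tgt

    K-saturate-step : ∀ {c} → Present c (src r) → ForcingStep (K n) r c (saturate c)
    K-saturate-step {c} (u , cu) v with c v ≟ tgt r
    ... | yes cv = (λ _ → refl) , λ unforced → ⊥-elim (unforced (K-forced cu cv))
    ... | no cv≢tgt = (λ forced → ⊥-elim (cv≢tgt (proj₁ forced))) , λ _ → refl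

    K-saturate-propagating : ∀ {c} → Present c (src r) → PropagatingStep (K n) r c (saturate c)
    K-saturate-propagating {c} src∈c =
      K-saturate-step src∈c ◅ ε , absent-tgt⇒inapplicable (K n) (saturate-absent-tgt c)

module _ {n : ℕ} where

  phase₁₂ : ∀ {c c'} → (∀ x → Present c x) → PropagatingStep (K n) (rule zero) c c' →
    Present c' c1 × Present c' c3 × Absent c' c2
  phase₁₂ all-present p@(fss , _) with K-propagating (λ ()) (all-present c1) p
  ... | c1∈c' , c2∉c' =
    c1∈c' , star-respects (Present-respects-step (K n) λ ()) fss (all-present c3) , c2∉c'

  phase₃₁ : ∀ {c c'} → Present c c3 → Absent c c2 →
    PropagatingStep (K n) (rule (suc (suc zero))) c c' → Monochrome c' c3
  phase₃₁ c3∈c c2∉c p@(fss , _) =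
    only-c3 (proj₂ (K-propagating (λ ()) c3∈c p))
            (star-respects (Absent-respects-step (K n) λ ()) fss c2∉c)

  rule₃₁-applicable : ∀ {c} → Present c c1 → Present c c3 →
    Applicable (K n) (rule (suc (suc zero))) c
  rule₃₁-applicable c1∈c c3∈c = K-applicable (λ ()) c3∈c c1∈c

  end-after-rule₂₃ : ∀ {c e} → Present c c1 → Present c c3 → Absent c c2 →
    Run (K n) (suc (suc zero)) c e → Monochrome e c3
  end-after-rule₂₃ c1∈c c3∈c _ (done stable) =
    ⊥-elim (stable (suc (suc zero)) (rule₃₁-applicable c1∈c c3∈c))
  end-after-rule₂₃ _ c3∈c c2∉c (step p run) = run-monochrome (K n) (phase₃₁ c3∈c c2∉c p) run

  end-after-rule₁₂ : ∀ {c e} → Present c c1 → Present c c3 → Absent c c2 →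
    Run (K n) (suc zero) c e → Monochrome e c3
  end-after-rule₁₂ c1∈c c3∈c _ (done stable) =
    ⊥-elim (stable (suc (suc zero)) (rule₃₁-applicable c1∈c c3∈c))
  end-after-rule₁₂ {c} c1∈c c3∈c c2∉c (step {c' = c'} (fss , _) run) =
    end-after-rule₂₃ (Present-resp-≗ c≗c' c1∈c) (Present-resp-≗ c≗c' c3∈c)
                     (Absent-resp-≗ c≗c' c2∉c) run
    where
    c≗c' : c ≗ c'
    c≗c' = sym ∘ star-fixes-absent-src (K n) c2∉c fss

  end-state-monochrome : ∀ {c e} → (∀ x → Present c x) → EndState (K n) c e → Monochrome e c3
  end-state-monochrome all-present (done stable) =
    ⊥-elim (stable zero (K-applicable (λ ()) (all-present c1) (all-present c2)))
  end-state-monochrome all-present (step p run) with phase₁₂ all-present p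
  ... | c1∈c' , c3∈c' , c2∉c' = end-after-rule₁₂ c1∈c' c3∈c' c2∉c' run

  end-state-exists : ∀ {c} → (∀ x → Present c x) → ∃[ e ] EndState (K n) c e
  end-state-exists {c} all-present =
    _ , step p₁₂ (step (ε , rule₂₃-inapplicable) (step p₃₁ (done (monochrome-stable (K n) mono))))
    where
    c' : Coloring n
    c' = saturate (λ ()) c
    c'' : Coloring n
    c'' = saturate (λ ()) c'
    p₁₂ : PropagatingStep (K n) (rule zero) c c'
    p₁₂ = K-saturate-propagating (λ ()) (all-present c1)
    c3∈c' : Present c' c3
    c3∈c' = proj₁ (proj₂ (phase₁₂ all-present p₁₂))
    c2∉c' : Absent c' c2
    c2∉c' = proj₂ (proj₂ (phase₁₂ all-present p₁₂))
    rule₂₃-inapplicable : ¬ Applicable (K n) (rule (suc zero)) c'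
    rule₂₃-inapplicable = absent-src⇒inapplicable (K n) c2∉c'
    p₃₁ : PropagatingStep (K n) (rule (suc (suc zero))) c' c''
    p₃₁ = K-saturate-propagating (λ ()) c3∈c'
    mono : Monochrome c'' c3
    mono = phase₃₁ c3∈c' c2∉c' p₃₁

lemma4p6 : (n : ℕ) (ℓ₀ : Coloring n) →
    (∀ (x : Color) → ∃[ v ] (ℓ₀ v ≡ x)) →
    (∃[ e ] EndState (K n) ℓ₀ e)
      × (∀ e → EndState (K n) ℓ₀ e → ∀ v → e v ≡ c3)
lemma4p6 n ℓ₀ all-present = end-state-exists all-present , λ _ → end-state-monochrome all-present
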